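{- Let $\omega=e^{2\pi i/3}$ and define integers $E_3(n)$ by $$\varepsilon_3(q):=\sum_{n=0}^{\infty}E_3(n)q^n=\sum_{n=0}^{\infty}q^{3n}(q^{n+1};q)_{\infty}\left((\omega q^{n+1};q)_{\infty}+(\omega^{2}q^{n+1};q)_{\infty}\right).$$ Then $$\varepsilon_3(q)=2-q-2q^2+\sum_{n=2}^{\infty}(-1)^n\chi_3(n-1)\,q^{\binom{n+1}{2}+1},$$ where $\chi_3(n)=\omega^n+\omega^{ -n}$, which equals $2$ if $3\mid n$ and $-1$ if $3\nmid n$.
   Context: For a complex $A$, $(A;q)_\infty=\prod_{i=0}^{\infty}(1-Aq^i)$, as a formal power series in $q$ (or for $|q|<1$). -}

module Defs where

open import Data.Nat as ℕ using (ℕ; zero; suc; _≤ᵇ_; _≡ᵇ_; _∸_)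
open import Data.Nat.Combinatorics using (_C_)
open import Data.Bool using (Bool; true; false; if_then_else_; _∧_)
open import Data.Integer as ℤ using (ℤ; +_; -[1+_])

-- The ring ℤ[ω], ω = e^{2πi/3}, with elements  a + b ω  (a b : ℤ),
-- using the relation ω² = -1 - ω.

record Zω : Set where
  constructor _+_ω
  field
    re : ℤ
    om : ℤ
open Zω public

infixl 6 _⊕_ _⊖_
infixl 7 _⊛_

_⊕_ : Zω → Zω → Zω
(a + b ω) ⊕ (c + d ω) = (a ℤ.+ c) + (b ℤ.+ d) ω

neg : Zω → Zω
neg (a + b ω) = (ℤ.- a) + (ℤ.- b) ω

_⊖_ : Zω → Zω → Zω
x ⊖ y = x ⊕ neg y

-- (a + bω)(c + dω) = ac + (ad + bc) ω + bd ω² = (ac - bd) + (ad + bc - bd) ω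
_⊛_ : Zω → Zω → Zω
(a + b ω) ⊛ (c + d ω) =
  (a ℤ.* c ℤ.- b ℤ.* d) + (a ℤ.* d ℤ.+ b ℤ.* c ℤ.- b ℤ.* d) ω

zeroω oneω ω ω² : Zω
zeroω = (+ 0) + (+ 0) ω
oneω  = (+ 1) + (+ 0) ω
ω     = (+ 0) + (+ 1) ω
ω²    = ω ⊛ ω

ι : ℤ → Zω
ι a = a + (+ 0) ω

pow : Zω → ℕ → Zω
pow x zero    = oneω
pow x (suc n) = pow x n ⊛ x

sumTo : (ℕ → Zω) → ℕ → Zω
sumTo f zero    = f 0
sumTo f (suc N) = sumTo f N ⊕ f (suc N)

-- Formal power series in q over ℤ[ω]: coefficient sequences.

FPS : Set
FPS = ℕ → Zω

_+S_ : FPS → FPS → FPS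
(f +S g) N = f N ⊕ g N

_*S_ : FPS → FPS → FPS
(f *S g) N = sumTo (λ k → f k ⊛ g (N ∸ k)) N

mono : Zω → ℕ → FPS
mono c k N = if N ≡ᵇ k then c else zeroω

shift : ℕ → FPS → FPS
shift m f N = if m ≤ᵇ N then f (N ∸ m) else zeroω

pochFin : Zω → ℕ → ℕ → FPS
pochFin A m zero    = mono oneω 0
pochFin A m (suc K) = pochFin A m K *S (mono oneω 0 +S mono (neg A) (m ℕ.+ K))

-- (A q^m ; q)_∞ as a formal power series: the coefficient of q^N is the
-- coefficient of q^N in the truncation ∏_{i=0}^{N} (1 - A q^{m+i}); all
-- later factors are ≡ 1 mod q^{N+1}, so this is the formal infinite product.
poch : Zω → ℕ → FPS
poch A m N = pochFin A m (suc N) N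

-- ε₃(q) = Σ_{n≥0} q^{3n} (q^{n+1};q)_∞ ((ω q^{n+1};q)_∞ + (ω² q^{n+1};q)_∞).
-- The n-th summand is divisible by q^{3n}, so only n ≤ N contribute to q^N.

eps3summand : ℕ → FPS
eps3summand n =
  shift (3 ℕ.* n) (poch oneω (suc n) *S (poch ω (suc n) +S poch ω² (suc n)))

E3 : ℕ → Zω
E3 N = sumTo (λ n → eps3summand n N) N

-- Right-hand side: 2 - q - 2q² + Σ_{n≥2} (-1)^n χ₃(n-1) q^{C(n+1,2)+1},
-- with χ₃(n) = ω^n + ω^{-n}, and ω^{-1} = ω².

χ₃ : ℕ → Zω
χ₃ n = pow ω n ⊕ pow ω² n

rhsTerm : ℕ → FPS
rhsTerm n N =
  if (2 ≤ᵇ n) ∧ (N ≡ᵇ suc ((suc n) C 2))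
  then pow (neg oneω) n ⊛ χ₃ (n ∸ 1)
  else zeroω

-- The exponent C(n+1,2)+1 exceeds n, so only n ≤ N contribute to q^N.
rhs : ℕ → Zω
rhs N = mono (ι (+ 2)) 0 N ⊕ mono (ι -[1+ 0 ]) 1 N ⊕ mono (ι -[1+ 1 ]) 2 N
        ⊕ sumTo (λ n → rhsTerm n N) N

-- For z ∈ {ω, ω²} let
--   A_m(z) = Σ_n q^{3n} (q^{n+1};q)_∞ (z q^{m+n+1};q)_∞,
--   R_m(z) = Σ_k (-z)^k q^{mk + T_k} (1 - q^{k+1}) (1 - q^{k+2}),   T_k = k(k+1)/2,
-- so that ε₃ = A_0(ω) + A_0(ω²). Splitting off the factor 1 - z q^{m+n+1} of the second
-- Pochhammer symbol in the summands of A_m, and the factor 1 - q^{n+1} of the first in those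
-- of A_{m+2}, shows
--   A_m = (1 - z q^{m+1}) A_{m+1} + z q^{m+4} A_{m+2};
-- R_m satisfies the same recurrence termwise, because (1 - q^{k+1}) (q^{k+2};q)_2 = (1 - q^{k+3}) (q^{k+1};q)_2.
-- Modulo q^{m+1} both A_m and R_m reduce to (1 - q)(1 - q²) (for A_m since
-- Σ_n q^{3n} (q^{n+1};q)_∞ = (q;q)_2), and the recurrence fixes coefficient N of A_m once
-- coefficient N of A_{m+1} and all lower coefficients are known, so A_0 = R_0. Finally, with
-- t_k = (-ω)^k + (-ω²)^k = (-1)^k χ₃(k), the expansion of Σ_k t_k q^{T_k} (1 - q^{k+1}) (1 - q^{k+2})
-- telescopes, because t_{k+2} - t_{k+1} + t_k = 0, to 2 - q - Σ_k t_k q^{T_{k+1} + 1}.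

module Submission where

open import Defs
open import Data.Nat using (ℕ)
open import Relation.Binary.PropositionalEquality using (_≡_)

open import Algebra.Bundles using (CommutativeRing)
open import Algebra.Definitions {A = Zω} _≡_
open import Data.Bool using (true; false)
open import Data.Integer using (+_; -[1+_]) renaming (_+_ to _+ℤ_; _-_ to _-ℤ_; _*_ to _*ℤ_)
import Data.Integer.Properties as ℤP
open import Data.Integer.Tactic.RingSolver using () renaming (solve-∀ to ℤ-solve-∀)
open import Data.Maybe using (Maybe; just; nothing)
open import Data.Nat using (zero; suc; _+_; _*_; _∸_; _≤_; _<_; z≤n; s≤s; z<s; _≤ᵇ_; _≡ᵇ_; _≤?_)
open import Data.Nat.Combinatorics using (_C_; nCk+nC[k+1]≡[n+1]C[k+1]; nC1≡n)
open import Data.Nat.Induction using (<-rec)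
open import Data.Nat.Properties
open import Data.Nat.Tactic.RingSolver using (solve-∀)
open import Data.Product using (_,_)
open import Data.Sum using (inj₁; inj₂)
open import Data.Unit using (tt)
open import Level using (0ℓ)
open import Relation.Binary.Bundles using (Setoid)
open import Relation.Binary.PropositionalEquality
import Relation.Binary.Reasoning.Setoid as SetoidReasoning
open import Relation.Nullary using (yes; no; contradiction)
import Tactic.RingSolver as Solver
open import Tactic.RingSolver.Core.AlmostCommutativeRing using (AlmostCommutativeRing; fromCommutativeRing)

⊕-assoc : Associative _⊕_
⊕-assoc (a + b ω) (c + d ω) (e + f ω) = cong₂ _+_ω (ℤP.+-assoc a c e) (ℤP.+-assoc b d f)

⊕-comm : Commutative _⊕_
⊕-comm (a + b ω) (c + d ω) = cong₂ _+_ω (ℤP.+-comm a c) (ℤP.+-comm b d)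

⊕-identityˡ : LeftIdentity zeroω _⊕_
⊕-identityˡ (a + b ω) = cong₂ _+_ω (ℤP.+-identityˡ a) (ℤP.+-identityˡ b)

⊕-identityʳ : RightIdentity zeroω _⊕_
⊕-identityʳ (a + b ω) = cong₂ _+_ω (ℤP.+-identityʳ a) (ℤP.+-identityʳ b)

neg-inverseˡ : LeftInverse zeroω neg _⊕_
neg-inverseˡ (a + b ω) = cong₂ _+_ω (ℤP.+-inverseˡ a) (ℤP.+-inverseˡ b)

neg-inverseʳ : RightInverse zeroω neg _⊕_
neg-inverseʳ (a + b ω) = cong₂ _+_ω (ℤP.+-inverseʳ a) (ℤP.+-inverseʳ b)

⊛-assoc : Associative _⊛_
⊛-assoc (a + b ω) (c + d ω) (e + f ω) = cong₂ _+_ω (re-assoc a b c d e f) (om-assoc a b c d e f)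
  where
  re-assoc : ∀ a b c d e f →
    (a *ℤ c -ℤ b *ℤ d) *ℤ e -ℤ (a *ℤ d +ℤ b *ℤ c -ℤ b *ℤ d) *ℤ f ≡
    a *ℤ (c *ℤ e -ℤ d *ℤ f) -ℤ b *ℤ (c *ℤ f +ℤ d *ℤ e -ℤ d *ℤ f)
  re-assoc = ℤ-solve-∀
  om-assoc : ∀ a b c d e f →
    (a *ℤ c -ℤ b *ℤ d) *ℤ f +ℤ (a *ℤ d +ℤ b *ℤ c -ℤ b *ℤ d) *ℤ e -ℤ (a *ℤ d +ℤ b *ℤ c -ℤ b *ℤ d) *ℤ f ≡
    a *ℤ (c *ℤ f +ℤ d *ℤ e -ℤ d *ℤ f) +ℤ b *ℤ (c *ℤ e -ℤ d *ℤ f) -ℤ b *ℤ (c *ℤ f +ℤ d *ℤ e -ℤ d *ℤ f)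
  om-assoc = ℤ-solve-∀

⊛-comm : Commutative _⊛_
⊛-comm (a + b ω) (c + d ω) = cong₂ _+_ω (re-comm a b c d) (om-comm a b c d)
  where
  re-comm : ∀ a b c d → a *ℤ c -ℤ b *ℤ d ≡ c *ℤ a -ℤ d *ℤ b
  re-comm = ℤ-solve-∀
  om-comm : ∀ a b c d → a *ℤ d +ℤ b *ℤ c -ℤ b *ℤ d ≡ c *ℤ b +ℤ d *ℤ a -ℤ d *ℤ b
  om-comm = ℤ-solve-∀

⊛-identityˡ : LeftIdentity oneω _⊛_
⊛-identityˡ (a + b ω) = cong₂ _+_ω (re-identity a b) (om-identity a b)
  where
  re-identity : ∀ a b → + 1 *ℤ a -ℤ + 0 *ℤ b ≡ a
  re-identity = ℤ-solve-∀
  om-identity : ∀ a b → + 1 *ℤ b +ℤ + 0 *ℤ a -ℤ + 0 *ℤ b ≡ b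
  om-identity = ℤ-solve-∀

⊛-identityʳ : RightIdentity oneω _⊛_
⊛-identityʳ x = trans (⊛-comm x oneω) (⊛-identityˡ x)

⊛-distribˡ-⊕ : _⊛_ DistributesOverˡ _⊕_
⊛-distribˡ-⊕ (a + b ω) (c + d ω) (e + f ω) = cong₂ _+_ω (re-distrib a b c d e f) (om-distrib a b c d e f)
  where
  re-distrib : ∀ a b c d e f → a *ℤ (c +ℤ e) -ℤ b *ℤ (d +ℤ f) ≡ (a *ℤ c -ℤ b *ℤ d) +ℤ (a *ℤ e -ℤ b *ℤ f)
  re-distrib = ℤ-solve-∀
  om-distrib : ∀ a b c d e f →
    a *ℤ (d +ℤ f) +ℤ b *ℤ (c +ℤ e) -ℤ b *ℤ (d +ℤ f) ≡
    (a *ℤ d +ℤ b *ℤ c -ℤ b *ℤ d) +ℤ (a *ℤ f +ℤ b *ℤ e -ℤ b *ℤ f)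
  om-distrib = ℤ-solve-∀

⊛-distribʳ-⊕ : _⊛_ DistributesOverʳ _⊕_
⊛-distribʳ-⊕ x y z =
  trans (⊛-comm (y ⊕ z) x) (trans (⊛-distribˡ-⊕ x y z) (cong₂ _⊕_ (⊛-comm x y) (⊛-comm x z)))

Zω-commutativeRing : CommutativeRing 0ℓ 0ℓ
Zω-commutativeRing = record
  { Carrier = Zω ; _≈_ = _≡_ ; _+_ = _⊕_ ; _*_ = _⊛_ ; -_ = neg ; 0# = zeroω ; 1# = oneω
  ; isCommutativeRing = record
    { isRing = record
      { +-isAbelianGroup = record
        { isGroup = record
          { isMonoid = record
            { isSemigroup = record
              { isMagma = record { isEquivalence = isEquivalence ; ∙-cong = cong₂ _⊕_ }
              ; assoc = ⊕-assoc }
            ; identity = ⊕-identityˡ , ⊕-identityʳ }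
          ; inverse = neg-inverseˡ , neg-inverseʳ
          ; ⁻¹-cong = cong neg }
        ; comm = ⊕-comm }
      ; *-cong = cong₂ _⊛_
      ; *-assoc = ⊛-assoc
      ; *-identity = ⊛-identityˡ , ⊛-identityʳ
      ; distrib = ⊛-distribˡ-⊕ , ⊛-distribʳ-⊕ }
    ; *-comm = ⊛-comm } }

open CommutativeRing Zω-commutativeRing using () renaming (zeroˡ to ⊛-zeroˡ; zeroʳ to ⊛-zeroʳ)

⊕-⊛-zeroʳ : ∀ x c → x ⊕ c ⊛ zeroω ≡ x
⊕-⊛-zeroʳ x c = trans (cong (x ⊕_) (⊛-zeroʳ c)) (⊕-identityʳ x)

Zω-ring : AlmostCommutativeRing 0ℓ 0ℓ
Zω-ring = fromCommutativeRing Zω-commutativeRing is-zero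
  where
  is-zero : ∀ x → Maybe (zeroω ≡ x)
  is-zero ((+ 0) + (+ 0) ω) = just refl
  is-zero _                 = nothing

sumTo-cong : ∀ {f g : ℕ → Zω} N → (∀ i → i ≤ N → f i ≡ g i) → sumTo f N ≡ sumTo g N
sumTo-cong zero    f≡g = f≡g 0 z≤n
sumTo-cong (suc N) f≡g =
  cong₂ _⊕_ (sumTo-cong N (λ i i≤N → f≡g i (m≤n⇒m≤1+n i≤N))) (f≡g (suc N) ≤-refl)

sumTo-⊕ : ∀ (f g : ℕ → Zω) N → sumTo (λ i → f i ⊕ g i) N ≡ sumTo f N ⊕ sumTo g N
sumTo-⊕ f g zero    = refl
sumTo-⊕ f g (suc N) =
  trans (cong (_⊕ (f (suc N) ⊕ g (suc N))) (sumTo-⊕ f g N)) (interchange (sumTo f N) (sumTo g N) (f (suc N)) (g (suc N)))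
  where
  interchange : ∀ a b c d → (a ⊕ b) ⊕ (c ⊕ d) ≡ (a ⊕ c) ⊕ (b ⊕ d)
  interchange = Solver.solve-∀ Zω-ring

sumTo-⊛ : ∀ c (f : ℕ → Zω) N → sumTo (λ i → c ⊛ f i) N ≡ c ⊛ sumTo f N
sumTo-⊛ c f zero    = refl
sumTo-⊛ c f (suc N) = trans (cong (_⊕ (c ⊛ f (suc N))) (sumTo-⊛ c f N)) (sym (⊛-distribˡ-⊕ c _ _))

sumTo-suc : ∀ (f : ℕ → Zω) N → sumTo f (suc N) ≡ f 0 ⊕ sumTo (λ i → f (suc i)) N
sumTo-suc f zero    = refl
sumTo-suc f (suc N) = trans (cong (_⊕ f (suc (suc N))) (sumTo-suc f N)) (⊕-assoc (f 0) _ _)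

sumTo-zero : ∀ {f : ℕ → Zω} N → (∀ i → i ≤ N → f i ≡ zeroω) → sumTo f N ≡ zeroω
sumTo-zero N f≡0 = trans (sumTo-cong N f≡0) (sumTo-const N)
  where
  sumTo-const : ∀ N → sumTo (λ _ → zeroω) N ≡ zeroω
  sumTo-const zero    = refl
  sumTo-const (suc N) = cong (_⊕ zeroω) (sumTo-const N)

sumTo-extend : ∀ {f : ℕ → Zω} M N → M ≤ N → (∀ i → M < i → f i ≡ zeroω) → sumTo f N ≡ sumTo f M
sumTo-extend     M zero    z≤n  _ = refl
sumTo-extend {f} M (suc N) M≤1+N f≡0 with m≤n⇒m<n∨m≡n M≤1+N
... | inj₂ refl         = refl
... | inj₁ (s≤s M≤N) = begin
  sumTo f N ⊕ f (suc N) ≡⟨ cong₂ _⊕_ (sumTo-extend M N M≤N f≡0) (f≡0 (suc N) (s≤s M≤N)) ⟩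
  sumTo f M ⊕ zeroω     ≡⟨ ⊕-identityʳ _ ⟩
  sumTo f M             ∎
  where open ≡-Reasoning

infix 4 _≈_
_≈_ : FPS → FPS → Set
f ≈ g = ∀ N → f N ≡ g N

≈-refl : ∀ {f} → f ≈ f
≈-refl _ = refl

≈-sym : ∀ {f g} → f ≈ g → g ≈ f
≈-sym f≈g N = sym (f≈g N)

≈-trans : ∀ {f g h} → f ≈ g → g ≈ h → f ≈ h
≈-trans f≈g g≈h N = trans (f≈g N) (g≈h N)

≈-setoid : Setoid 0ℓ 0ℓ
≈-setoid = record
  { Carrier       = FPS
  ; _≈_           = _≈_
  ; isEquivalence = record { refl = ≈-refl ; sym = ≈-sym ; trans = ≈-trans } }

module ≈-Reasoning = SetoidReasoning ≈-setoid

zeroS oneS : FPS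
zeroS _ = zeroω
oneS    = mono oneω 0

scale : Zω → FPS → FPS
scale c f N = c ⊛ f N

infixr 25 [1-_q^_]_
[1-_q^_]_ : Zω → ℕ → FPS → FPS
[1- c q^ j ] f = f +S scale (neg c) (shift j f)

+S-cong : ∀ {f f' g g'} → f ≈ f' → g ≈ g' → f +S g ≈ f' +S g'
+S-cong f≈f' g≈g' N = cong₂ _⊕_ (f≈f' N) (g≈g' N)

+S-congˡ : ∀ f {g g'} → g ≈ g' → f +S g ≈ f +S g'
+S-congˡ f g≈g' N = cong (f N ⊕_) (g≈g' N)

+S-congʳ : ∀ g {f f'} → f ≈ f' → f +S g ≈ f' +S g
+S-congʳ g f≈f' N = cong (_⊕ g N) (f≈f' N)

+S-identityˡ : ∀ f → zeroS +S f ≈ f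
+S-identityˡ f N = ⊕-identityˡ (f N)

+S-assoc : ∀ f g h → (f +S g) +S h ≈ f +S (g +S h)
+S-assoc f g h N = ⊕-assoc (f N) (g N) (h N)

scale-cong : ∀ c {f g} → f ≈ g → scale c f ≈ scale c g
scale-cong c f≈g N = cong (c ⊛_) (f≈g N)

shift-≤ : ∀ {j N} f → j ≤ N → shift j f N ≡ f (N ∸ j)
shift-≤ {j} {N} f j≤N with j ≤ᵇ N | ≤⇒≤ᵇ j≤N
... | true | _ = refl

shift-< : ∀ {j N} f → N < j → shift j f N ≡ zeroω
shift-< {j} {N} f N<j with j ≤ᵇ N | ≤ᵇ⇒≤ j N
... | true  | j≤N = contradiction (j≤N tt) (<⇒≱ N<j)
... | false | _   = refl

shift-suc : ∀ j f N → shift (suc j) f (suc N) ≡ shift j f N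
shift-suc zero    f N = refl
shift-suc (suc j) f N = refl

shift-cong : ∀ j {f g} → f ≈ g → shift j f ≈ shift j g
shift-cong j f≈g N with j ≤ᵇ N
... | true  = f≈g (N ∸ j)
... | false = refl

shift-zeroS : ∀ j → shift j zeroS ≈ zeroS
shift-zeroS j N with j ≤ᵇ N
... | true  = refl
... | false = refl

shift-+S : ∀ j f g → shift j (f +S g) ≈ shift j f +S shift j g
shift-+S j f g N with j ≤ᵇ N
... | true  = refl
... | false = sym (⊕-identityʳ zeroω)

shift-scale : ∀ j c f → shift j (scale c f) ≈ scale c (shift j f)
shift-scale j c f N with j ≤ᵇ N
... | true  = refl
... | false = sym (⊛-zeroʳ c)

shift-shift : ∀ i j f → shift i (shift j f) ≈ shift (i + j) f
shift-shift zero    j f N       = refl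
shift-shift (suc i) j f zero    = refl
shift-shift (suc i) j f (suc N) = begin
  shift (suc i) (shift j f) (suc N) ≡⟨ shift-suc i (shift j f) N ⟩
  shift i (shift j f) N             ≡⟨ shift-shift i j f N ⟩
  shift (i + j) f N                 ≡⟨ shift-suc (i + j) f N ⟨
  shift (suc i + j) f (suc N)       ∎
  where open ≡-Reasoning

shift-scale-shift : ∀ i c j f N → shift i (scale c (shift j f)) N ≡ c ⊛ shift (i + j) f N
shift-scale-shift i c j f N = trans (shift-scale i c (shift j f) N) (cong (c ⊛_) (shift-shift i j f N))

shift-agree : ∀ j {f g} N → (∀ M → M + j ≤ N → f M ≡ g M) → shift j f N ≡ shift j g N
shift-agree j {f} {g} N f≡g with j ≤? N
... | yes j≤N = begin
  shift j f N ≡⟨ shift-≤ f j≤N ⟩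
  f (N ∸ j)   ≡⟨ f≡g (N ∸ j) (≤-reflexive (m∸n+n≡m j≤N)) ⟩
  g (N ∸ j)   ≡⟨ shift-≤ g j≤N ⟨
  shift j g N ∎
  where open ≡-Reasoning
... | no j≰N = trans (shift-< f (≰⇒> j≰N)) (sym (shift-< g (≰⇒> j≰N)))

mono≈scale-shift : ∀ c j → mono c j ≈ scale c (shift j oneS)
mono≈scale-shift c zero    zero    = sym (⊛-identityʳ c)
mono≈scale-shift c zero    (suc N) = sym (⊛-zeroʳ c)
mono≈scale-shift c (suc j) zero    = sym (⊛-zeroʳ c)
mono≈scale-shift c (suc j) (suc N) =
  trans (mono≈scale-shift c j N) (cong (c ⊛_) (sym (shift-suc j oneS N)))

mono-⊕ : ∀ a b e N → mono a e N ⊕ mono b e N ≡ mono (a ⊕ b) e N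
mono-⊕ a b e N with N ≡ᵇ e
... | true  = refl
... | false = refl

mono-zeroω : ∀ e N → mono zeroω e N ≡ zeroω
mono-zeroω e N with N ≡ᵇ e
... | true  = refl
... | false = refl

mono-below : ∀ c {e M} → M < e → mono c e M ≡ zeroω
mono-below c {e} {M} M<e = trans (mono≈scale-shift c e M) (trans (cong (c ⊛_) (shift-< oneS M<e)) (⊛-zeroʳ c))

[1-]-cong : ∀ c j {f g} → f ≈ g → [1- c q^ j ] f ≈ [1- c q^ j ] g
[1-]-cong c j f≈g = +S-cong f≈g (scale-cong (neg c) (shift-cong j f≈g))

shift-[1-] : ∀ i c j f N → shift i ([1- c q^ j ] f) N ≡ shift i f N ⊕ neg c ⊛ shift (i + j) f N
shift-[1-] i c j f N = begin
  shift i ([1- c q^ j ] f) N                           ≡⟨ shift-+S i f (scale (neg c) (shift j f)) N ⟩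
  shift i f N ⊕ shift i (scale (neg c) (shift j f)) N  ≡⟨ cong (shift i f N ⊕_) (shift-scale i (neg c) (shift j f) N) ⟩
  shift i f N ⊕ neg c ⊛ shift i (shift j f) N          ≡⟨ cong (λ x → shift i f N ⊕ neg c ⊛ x) (shift-shift i j f N) ⟩
  shift i f N ⊕ neg c ⊛ shift (i + j) f N              ∎
  where open ≡-Reasoning

[1-]-comm : ∀ a i b j f → [1- a q^ i ] [1- b q^ j ] f ≈ [1- b q^ j ] [1- a q^ i ] f
[1-]-comm a i b j f N = begin
  ([1- a q^ i ] [1- b q^ j ] f) N
    ≡⟨ cong (([1- b q^ j ] f) N ⊕_) (cong (neg a ⊛_) (shift-[1-] i b j f N)) ⟩
  (f N ⊕ neg b ⊛ shift j f N) ⊕ neg a ⊛ (shift i f N ⊕ neg b ⊛ shift (i + j) f N)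
    ≡⟨ cong (λ k → (f N ⊕ neg b ⊛ shift j f N) ⊕ neg a ⊛ (shift i f N ⊕ neg b ⊛ shift k f N)) (+-comm i j) ⟩
  (f N ⊕ neg b ⊛ shift j f N) ⊕ neg a ⊛ (shift i f N ⊕ neg b ⊛ shift (j + i) f N)
    ≡⟨ swap (f N) (shift j f N) (shift i f N) (shift (j + i) f N) (neg a) (neg b) ⟩
  (f N ⊕ neg a ⊛ shift i f N) ⊕ neg b ⊛ (shift j f N ⊕ neg a ⊛ shift (j + i) f N)
    ≡⟨ cong (([1- a q^ i ] f) N ⊕_) (cong (neg b ⊛_) (shift-[1-] j a i f N)) ⟨
  ([1- b q^ j ] [1- a q^ i ] f) N ∎
  where
  open ≡-Reasoning
  swap : ∀ x y z w p q → (x ⊕ q ⊛ y) ⊕ p ⊛ (z ⊕ q ⊛ w) ≡ (x ⊕ p ⊛ z) ⊕ q ⊛ (y ⊕ p ⊛ w)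
  swap = Solver.solve-∀ Zω-ring

*S-congʳ : ∀ {f f'} g → f ≈ f' → f *S g ≈ f' *S g
*S-congʳ g f≈f' N = sumTo-cong N (λ k _ → cong (_⊛ g (N ∸ k)) (f≈f' k))

*S-congˡ : ∀ f {g g'} → g ≈ g' → f *S g ≈ f *S g'
*S-congˡ f g≈g' N = sumTo-cong N (λ k _ → cong (f k ⊛_) (g≈g' (N ∸ k)))

*S-identityʳ : ∀ f → f *S oneS ≈ f
*S-identityʳ f zero    = ⊛-identityʳ (f 0)
*S-identityʳ f (suc N) = begin
  sumTo (λ k → f k ⊛ oneS (suc N ∸ k)) N ⊕ f (suc N) ⊛ oneS (N ∸ N)
    ≡⟨ cong₂ _⊕_ (sumTo-zero N (λ k k≤N → trans (cong (λ i → f k ⊛ oneS i) (+-∸-assoc 1 k≤N)) (⊛-zeroʳ (f k))))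
                 (trans (cong (λ i → f (suc N) ⊛ oneS i) (n∸n≡0 N)) (⊛-identityʳ (f (suc N)))) ⟩
  zeroω ⊕ f (suc N)
    ≡⟨ ⊕-identityˡ (f (suc N)) ⟩
  f (suc N) ∎
  where open ≡-Reasoning

*S-agrees-with-oneS : ∀ f g N → (∀ i → i ≤ N → g i ≡ oneS i) → (f *S g) N ≡ f N
*S-agrees-with-oneS f g N g≡1 =
  trans (sumTo-cong N (λ k _ → cong (f k ⊛_) (g≡1 (N ∸ k) (m∸n≤m N k)))) (*S-identityʳ f N)

*S-distribˡ : ∀ f g h → f *S (g +S h) ≈ (f *S g) +S (f *S h)
*S-distribˡ f g h N = trans (sumTo-cong N (λ k _ → ⊛-distribˡ-⊕ (f k) (g (N ∸ k)) (h (N ∸ k))))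
                            (sumTo-⊕ (λ k → f k ⊛ g (N ∸ k)) (λ k → f k ⊛ h (N ∸ k)) N)

*S-distribʳ : ∀ f g h → (f +S g) *S h ≈ (f *S h) +S (g *S h)
*S-distribʳ f g h N = trans (sumTo-cong N (λ k _ → ⊛-distribʳ-⊕ (h (N ∸ k)) (f k) (g k)))
                            (sumTo-⊕ (λ k → f k ⊛ h (N ∸ k)) (λ k → g k ⊛ h (N ∸ k)) N)

*S-scaleˡ : ∀ c f g → scale c f *S g ≈ scale c (f *S g)
*S-scaleˡ c f g N = trans (sumTo-cong N (λ k _ → ⊛-assoc c (f k) (g (N ∸ k))))
                          (sumTo-⊛ c (λ k → f k ⊛ g (N ∸ k)) N)

*S-scaleʳ : ∀ f c g → f *S scale c g ≈ scale c (f *S g)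
*S-scaleʳ f c g N = trans (sumTo-cong N (λ k _ → left-comm (f k) c (g (N ∸ k))))
                          (sumTo-⊛ c (λ k → f k ⊛ g (N ∸ k)) N)
  where
  left-comm : ∀ a b d → a ⊛ (b ⊛ d) ≡ b ⊛ (a ⊛ d)
  left-comm = Solver.solve-∀ Zω-ring

private
  *S-shift1ˡ : ∀ f g → shift 1 f *S g ≈ shift 1 (f *S g)
  *S-shift1ˡ f g zero    = ⊛-zeroˡ (g 0)
  *S-shift1ˡ f g (suc N) = begin
    sumTo (λ k → shift 1 f k ⊛ g (suc N ∸ k)) (suc N) ≡⟨ sumTo-suc (λ k → shift 1 f k ⊛ g (suc N ∸ k)) N ⟩
    zeroω ⊛ g (suc N) ⊕ (f *S g) N                    ≡⟨ cong (_⊕ (f *S g) N) (⊛-zeroˡ (g (suc N))) ⟩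
    zeroω ⊕ (f *S g) N                                ≡⟨ ⊕-identityˡ ((f *S g) N) ⟩
    (f *S g) N                                        ∎
    where open ≡-Reasoning

  *S-shift1ʳ : ∀ f g → f *S shift 1 g ≈ shift 1 (f *S g)
  *S-shift1ʳ f g zero    = ⊛-zeroʳ (f 0)
  *S-shift1ʳ f g (suc N) = begin
    sumTo (λ k → f k ⊛ shift 1 g (suc N ∸ k)) N ⊕ f (suc N) ⊛ shift 1 g (N ∸ N)
      ≡⟨ cong₂ _⊕_ (sumTo-cong N (λ k k≤N → cong (λ i → f k ⊛ shift 1 g i) (+-∸-assoc 1 k≤N)))
                   (trans (cong (λ i → f (suc N) ⊛ shift 1 g i) (n∸n≡0 N)) (⊛-zeroʳ (f (suc N)))) ⟩
    (f *S g) N ⊕ zeroω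
      ≡⟨ ⊕-identityʳ ((f *S g) N) ⟩
    (f *S g) N ∎
    where open ≡-Reasoning

*S-shiftˡ : ∀ j f g → shift j f *S g ≈ shift j (f *S g)
*S-shiftˡ zero    f g N = refl
*S-shiftˡ (suc j) f g   = begin
  shift (suc j) f *S g       ≈⟨ *S-congʳ g (shift-shift 1 j f) ⟨
  shift 1 (shift j f) *S g   ≈⟨ *S-shift1ˡ (shift j f) g ⟩
  shift 1 (shift j f *S g)   ≈⟨ shift-cong 1 (*S-shiftˡ j f g) ⟩
  shift 1 (shift j (f *S g)) ≈⟨ shift-shift 1 j (f *S g) ⟩
  shift (suc j) (f *S g)     ∎
  where open ≈-Reasoning

*S-shiftʳ : ∀ j f g → f *S shift j g ≈ shift j (f *S g)
*S-shiftʳ zero    f g N = refl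
*S-shiftʳ (suc j) f g   = begin
  f *S shift (suc j) g       ≈⟨ *S-congˡ f (shift-shift 1 j g) ⟨
  f *S shift 1 (shift j g)   ≈⟨ *S-shift1ʳ f (shift j g) ⟩
  shift 1 (f *S shift j g)   ≈⟨ shift-cong 1 (*S-shiftʳ j f g) ⟩
  shift 1 (shift j (f *S g)) ≈⟨ shift-shift 1 j (f *S g) ⟩
  shift (suc j) (f *S g)     ∎
  where open ≈-Reasoning

*S-[1-]ˡ : ∀ c j f g → ([1- c q^ j ] f) *S g ≈ [1- c q^ j ] (f *S g)
*S-[1-]ˡ c j f g = begin
  ([1- c q^ j ] f) *S g                                     ≈⟨ *S-distribʳ f (scale (neg c) (shift j f)) g ⟩
  (f *S g) +S (scale (neg c) (shift j f) *S g)              ≈⟨ +S-congˡ (f *S g) (*S-scaleˡ (neg c) (shift j f) g) ⟩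
  (f *S g) +S scale (neg c) (shift j f *S g)                ≈⟨ +S-congˡ (f *S g) (scale-cong (neg c) (*S-shiftˡ j f g)) ⟩
  [1- c q^ j ] (f *S g)                                     ∎
  where open ≈-Reasoning

*S-[1-]ʳ : ∀ f c j g → f *S ([1- c q^ j ] g) ≈ [1- c q^ j ] (f *S g)
*S-[1-]ʳ f c j g = begin
  f *S ([1- c q^ j ] g)                                     ≈⟨ *S-distribˡ f g (scale (neg c) (shift j g)) ⟩
  (f *S g) +S (f *S scale (neg c) (shift j g))              ≈⟨ +S-congˡ (f *S g) (*S-scaleʳ f (neg c) (shift j g)) ⟩
  (f *S g) +S scale (neg c) (f *S shift j g)                ≈⟨ +S-congˡ (f *S g) (scale-cong (neg c) (*S-shiftʳ j f g)) ⟩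
  [1- c q^ j ] (f *S g)                                     ∎
  where open ≈-Reasoning

*S-binomial : ∀ f c j → f *S (oneS +S mono (neg c) j) ≈ [1- c q^ j ] f
*S-binomial f c j = begin
  f *S (oneS +S mono (neg c) j) ≈⟨ *S-congˡ f (+S-congˡ oneS (mono≈scale-shift (neg c) j)) ⟩
  f *S ([1- c q^ j ] oneS)      ≈⟨ *S-[1-]ʳ f c j oneS ⟩
  [1- c q^ j ] (f *S oneS)      ≈⟨ [1-]-cong c j (*S-identityʳ f) ⟩
  [1- c q^ j ] f                ∎
  where open ≈-Reasoning

-- Coefficient N only sees the summands n ≤ N; for a Summable family this is the infinite sum.
SUM : (ℕ → FPS) → FPS
SUM F N = sumTo (λ n → F n N) N

Summable : (ℕ → FPS) → Set
Summable F = ∀ n M → M < n → F n M ≡ zeroω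

Summable-suc : ∀ {F} → Summable F → Summable (λ n → F (suc n))
Summable-suc F-summable n M M<n = F-summable (suc n) M (m≤n⇒m≤1+n M<n)

SUM-cong : ∀ {F G} → (∀ n → F n ≈ G n) → SUM F ≈ SUM G
SUM-cong F≈G N = sumTo-cong N (λ n _ → F≈G n N)

SUM-+S : ∀ F G → SUM (λ n → F n +S G n) ≈ SUM F +S SUM G
SUM-+S F G N = sumTo-⊕ (λ n → F n N) (λ n → G n N) N

SUM-scale : ∀ c F → SUM (λ n → scale c (F n)) ≈ scale c (SUM F)
SUM-scale c F N = sumTo-⊛ c (λ n → F n N) N

SUM-shift : ∀ j {F} → Summable F → SUM (λ n → shift j (F n)) ≈ shift j (SUM F)
SUM-shift j {F} F-summable N with j ≤? N
... | yes j≤N = begin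
  sumTo (λ n → shift j (F n) N) N ≡⟨ sumTo-cong N (λ n _ → shift-≤ (F n) j≤N) ⟩
  sumTo (λ n → F n (N ∸ j)) N     ≡⟨ sumTo-extend (N ∸ j) N (m∸n≤m N j) (λ n → F-summable n (N ∸ j)) ⟩
  SUM F (N ∸ j)                   ≡⟨ shift-≤ (SUM F) j≤N ⟨
  shift j (SUM F) N               ∎
  where open ≡-Reasoning
... | no j≰N = trans (sumTo-zero N (λ n _ → shift-< (F n) (≰⇒> j≰N))) (sym (shift-< (SUM F) (≰⇒> j≰N)))

SUM-suc : ∀ {F} → Summable F → SUM F ≈ F 0 +S SUM (λ n → F (suc n))
SUM-suc {F} F-summable zero    = sym (trans (cong (F 0 0 ⊕_) (F-summable 1 0 (s≤s z≤n))) (⊕-identityʳ (F 0 0)))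
SUM-suc {F} F-summable (suc N) = begin
  sumTo (λ n → F n (suc N)) (suc N)
    ≡⟨ sumTo-suc (λ n → F n (suc N)) N ⟩
  F 0 (suc N) ⊕ sumTo (λ n → F (suc n) (suc N)) N
    ≡⟨ cong (F 0 (suc N) ⊕_) (⊕-identityʳ (sumTo (λ n → F (suc n) (suc N)) N)) ⟨
  F 0 (suc N) ⊕ (sumTo (λ n → F (suc n) (suc N)) N ⊕ zeroω)
    ≡⟨ cong (λ x → F 0 (suc N) ⊕ (sumTo (λ n → F (suc n) (suc N)) N ⊕ x)) (F-summable (2 + N) (suc N) ≤-refl) ⟨
  F 0 (suc N) ⊕ SUM (λ n → F (suc n)) (suc N) ∎
  where open ≡-Reasoning

mono-summable : ∀ (c : ℕ → Zω) (e : ℕ → ℕ) → (∀ k → k ≤ e k) → Summable (λ k → mono (c k) (e k))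
mono-summable c e k≤e k M M<k = mono-below (c k) (<-≤-trans M<k (k≤e k))

-- q-Pochhammer symbols

pochFin-suc : ∀ A m K → pochFin A m (suc K) ≈ [1- A q^ (m + K) ] pochFin A m K
pochFin-suc A m K = *S-binomial (pochFin A m K) A (m + K)

pochFin-stable : ∀ A m K N → N < m + K → pochFin A m (suc K) N ≡ pochFin A m K N
pochFin-stable A m K N N<m+K = begin
  pochFin A m (suc K) N           ≡⟨ pochFin-suc A m K N ⟩
  f N ⊕ neg A ⊛ shift (m + K) f N ≡⟨ cong (λ x → f N ⊕ neg A ⊛ x) (shift-< f N<m+K) ⟩
  f N ⊕ neg A ⊛ zeroω             ≡⟨ ⊕-⊛-zeroʳ (f N) (neg A) ⟩
  f N                             ∎
  where
  open ≡-Reasoning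
  f = pochFin A m K

pochFin-stable-≤ : ∀ A m {K L} N → K ≤ L → N < m + K → pochFin A m L N ≡ pochFin A m K N
pochFin-stable-≤ A m {L = zero}  N z≤n   _     = refl
pochFin-stable-≤ A m {L = suc L} N K≤1+L N<m+K with m≤n⇒m<n∨m≡n K≤1+L
... | inj₂ refl      = refl
... | inj₁ (s≤s K≤L) = trans (pochFin-stable A m L N (<-≤-trans N<m+K (+-monoʳ-≤ m K≤L)))
                             (pochFin-stable-≤ A m N K≤L N<m+K)

poch≡pochFin : ∀ A m K N → N < m + K → poch A m N ≡ pochFin A m K N
poch≡pochFin A m K N N<m+K with ≤-total K (suc N)
... | inj₁ K≤1+N = pochFin-stable-≤ A m N K≤1+N N<m+K
... | inj₂ 1+N≤K = sym (pochFin-stable-≤ A m N 1+N≤K (m≤n+m (suc N) m))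

poch-below : ∀ A m N → N < m → poch A m N ≡ oneS N
poch-below A m N N<m = poch≡pochFin A m 0 N (subst (N <_) (sym (+-identityʳ m)) N<m)

pochFin-peel : ∀ A m K → pochFin A m (suc K) ≈ [1- A q^ m ] pochFin A (suc m) K
pochFin-peel A m zero = begin
  pochFin A m 1            ≈⟨ pochFin-suc A m 0 ⟩
  [1- A q^ (m + 0) ] oneS  ≡⟨ cong (λ k → [1- A q^ k ] oneS) (+-identityʳ m) ⟩
  [1- A q^ m ] oneS        ∎
  where open ≈-Reasoning
pochFin-peel A m (suc K) = begin
  pochFin A m (2 + K)                                          ≈⟨ pochFin-suc A m (suc K) ⟩
  [1- A q^ (m + suc K) ] pochFin A m (suc K)                   ≈⟨ [1-]-cong A (m + suc K) (pochFin-peel A m K) ⟩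
  [1- A q^ (m + suc K) ] [1- A q^ m ] pochFin A (suc m) K      ≈⟨ [1-]-comm A (m + suc K) A m (pochFin A (suc m) K) ⟩
  [1- A q^ m ] [1- A q^ (m + suc K) ] pochFin A (suc m) K      ≡⟨ cong (λ k → [1- A q^ m ] [1- A q^ k ] pochFin A (suc m) K) (+-suc m K) ⟩
  [1- A q^ m ] [1- A q^ (suc m + K) ] pochFin A (suc m) K      ≈⟨ [1-]-cong A m (pochFin-suc A (suc m) K) ⟨
  [1- A q^ m ] pochFin A (suc m) (suc K)                       ∎
  where open ≈-Reasoning

pochFin-first≈last : ∀ A m K → [1- A q^ m ] pochFin A (suc m) K ≈ [1- A q^ (m + K) ] pochFin A m K
pochFin-first≈last A m K = ≈-trans (≈-sym (pochFin-peel A m K)) (pochFin-suc A m K)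

poch-suc : ∀ A m → poch A m ≈ [1- A q^ m ] poch A (suc m)
poch-suc A m N = begin
  pochFin A m (suc N) N
    ≡⟨ pochFin-peel A m N N ⟩
  pochFin A (suc m) N N ⊕ neg A ⊛ shift m (pochFin A (suc m) N) N
    ≡⟨ cong₂ (λ x y → x ⊕ neg A ⊛ y) (sym (agree ≤-refl))
             (shift-agree m N (λ M M+m≤N → sym (agree (≤-trans (m≤m+n M m) M+m≤N)))) ⟩
  poch A (suc m) N ⊕ neg A ⊛ shift m (poch A (suc m)) N
    ∎
  where
  open ≡-Reasoning
  agree : ∀ {M} → M ≤ N → poch A (suc m) M ≡ pochFin A (suc m) N M
  agree {M} M≤N = poch≡pochFin A (suc m) N M (s≤s (≤-trans M≤N (m≤n+m N m)))

-- The series Σₙ q^(jn) (q^(n+1);q)_∞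

P : ℕ → FPS
P n = poch oneω (suc n)

Bterm : ℕ → ℕ → FPS
Bterm j n = shift (j * n) (P n)

B : ℕ → FPS
B j = SUM (Bterm j)

Bterm-summable : ∀ j → Summable (Bterm (suc j))
Bterm-summable j n M M<n = shift-< (P n) (<-≤-trans M<n (m≤m+n n (j * n)))

Bterm-suc : ∀ j n → Bterm (2 + j) (suc n) ≈ Bterm (suc j) (suc n) +S scale (neg oneω) (shift (suc j) (Bterm (suc j) n))
Bterm-suc j n N = sym (begin
  X ⊕ neg oneω ⊛ shift (suc j) (shift (suc j * n) (P n)) N
    ≡⟨ cong (λ x → X ⊕ neg oneω ⊛ x) (shift-shift (suc j) (suc j * n) (P n) N) ⟩
  X ⊕ neg oneω ⊛ shift e (P n) N
    ≡⟨ cong (λ x → X ⊕ neg oneω ⊛ x) (trans (shift-cong e (poch-suc oneω (suc n)) N) (shift-[1-] e oneω (suc n) (P (suc n)) N)) ⟩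
  X ⊕ neg oneω ⊛ (shift e (P (suc n)) N ⊕ neg oneω ⊛ shift (e + suc n) (P (suc n)) N)
    ≡⟨ cong₂ (λ i k → X ⊕ neg oneω ⊛ (shift i (P (suc n)) N ⊕ neg oneω ⊛ shift k (P (suc n)) N))
             (exponent₁ j n) (exponent₂ j n) ⟩
  X ⊕ neg oneω ⊛ (X ⊕ neg oneω ⊛ Y)
    ≡⟨ cancel X Y ⟩
  Y ∎)
  where
  open ≡-Reasoning
  e = suc j + suc j * n
  X = Bterm (suc j) (suc n) N
  Y = Bterm (2 + j) (suc n) N
  exponent₁ : ∀ j n → suc j + suc j * n ≡ suc j * suc n
  exponent₁ = solve-∀
  exponent₂ : ∀ j n → suc j + suc j * n + suc n ≡ (2 + j) * suc n
  exponent₂ = solve-∀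
  cancel : ∀ x y → x ⊕ neg oneω ⊛ (x ⊕ neg oneω ⊛ y) ≡ y
  cancel = Solver.solve-∀ Zω-ring

B-one : B 1 ≈ oneS
B-one N = trans (partial-sum N N) (poch-below oneω (suc N) N ≤-refl)
  where
  open ≡-Reasoning
  cancel : ∀ x y → (x ⊕ neg oneω ⊛ y) ⊕ y ≡ x
  cancel = Solver.solve-∀ Zω-ring
  partial-sum : ∀ K N → sumTo (λ n → Bterm 1 n N) K ≡ P K N
  partial-sum zero    N = refl
  partial-sum (suc K) N = begin
    sumTo (λ n → Bterm 1 n N) K ⊕ Bterm 1 (suc K) N
      ≡⟨ cong₂ _⊕_ (trans (partial-sum K N) (poch-suc oneω (suc K) N))
                   (cong (λ j → shift j (P (suc K)) N) (*-identityˡ (suc K))) ⟩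
    (P (suc K) N ⊕ neg oneω ⊛ shift (suc K) (P (suc K)) N) ⊕ shift (suc K) (P (suc K)) N
      ≡⟨ cancel (P (suc K) N) (shift (suc K) (P (suc K)) N) ⟩
    P (suc K) N ∎

B-suc : ∀ j → B (2 + j) ≈ [1- oneω q^ (suc j) ] B (suc j)
B-suc j = begin
  SUM b′                                   ≈⟨ SUM-suc (Bterm-summable (suc j)) ⟩
  b′ 0 +S SUM (λ n → b′ (suc n))           ≈⟨ +S-congˡ (b 0) (SUM-cong (Bterm-suc j)) ⟩
  b 0 +S SUM (λ n → b (suc n) +S d n)      ≈⟨ +S-congˡ (b 0) (SUM-+S (λ n → b (suc n)) d) ⟩
  b 0 +S (SUM (λ n → b (suc n)) +S SUM d)  ≈⟨ +S-assoc (b 0) (SUM (λ n → b (suc n))) (SUM d) ⟨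
  (b 0 +S SUM (λ n → b (suc n))) +S SUM d
    ≈⟨ +S-cong (≈-sym (SUM-suc (Bterm-summable j)))
               (≈-trans (SUM-scale (neg oneω) (λ n → shift (suc j) (b n)))
                        (scale-cong (neg oneω) (SUM-shift (suc j) (Bterm-summable j)))) ⟩
  [1- oneω q^ (suc j) ] B (suc j)          ∎
  where
  open ≈-Reasoning
  b b′ d : ℕ → FPS
  b  = Bterm (suc j)
  b′ = Bterm (2 + j)
  d n = scale (neg oneω) (shift (suc j) (b n))

B≈pochFin : ∀ j → B (suc j) ≈ pochFin oneω 1 j
B≈pochFin zero    = B-one
B≈pochFin (suc j) = begin
  B (2 + j)                                ≈⟨ B-suc j ⟩
  [1- oneω q^ (suc j) ] B (suc j)          ≈⟨ [1-]-cong oneω (suc j) (B≈pochFin j) ⟩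
  [1- oneω q^ (suc j) ] pochFin oneω 1 j   ≈⟨ pochFin-suc oneω 1 j ⟨
  pochFin oneω 1 (suc j)                   ∎
  where open ≈-Reasoning

-- The recurrence

-- The two occurrences of X (m + 1) are separate arguments because in the termwise recurrence of R
-- they come from different summands.
recStep : Zω → ℕ → FPS → FPS → FPS → FPS
recStep z m f g h = (f +S scale (neg z) (shift (suc m) g)) +S scale z (shift (4 + m) h)

Recurrence : Zω → (ℕ → FPS) → Set
Recurrence z X = ∀ m → X m ≈ recStep z m (X (suc m)) (X (suc m)) (X (2 + m))

recStep-cong : ∀ z m {f f' g g' h h'} → f ≈ f' → g ≈ g' → h ≈ h' → recStep z m f g h ≈ recStep z m f' g' h'
recStep-cong z m f≈f' g≈g' h≈h' =
  +S-cong (+S-cong f≈f' (scale-cong (neg z) (shift-cong (suc m) g≈g'))) (scale-cong z (shift-cong (4 + m) h≈h'))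

recStep-zeroS : ∀ z m f g → recStep z m f g zeroS ≈ f +S scale (neg z) (shift (suc m) g)
recStep-zeroS z m f g N =
  trans (cong (λ x → (f N ⊕ neg z ⊛ shift (suc m) g N) ⊕ z ⊛ x) (shift-zeroS (4 + m) N))
        (⊕-⊛-zeroʳ (f N ⊕ neg z ⊛ shift (suc m) g N) z)

recStep-+S : ∀ z m f g h f' g' h' → recStep z m f g h +S recStep z m f' g' h' ≈ recStep z m (f +S f') (g +S g') (h +S h')
recStep-+S z m f g h f' g' h' N =
  trans (regroup (f N) (f' N) (shift (suc m) g N) (shift (suc m) g' N) (shift (4 + m) h N) (shift (4 + m) h' N) z)
        (sym (cong₂ (λ x y → (f N ⊕ f' N ⊕ neg z ⊛ x) ⊕ z ⊛ y) (shift-+S (suc m) g g' N) (shift-+S (4 + m) h h' N)))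
  where
  regroup : ∀ a a' b b' c c' z →
    ((a ⊕ neg z ⊛ b) ⊕ z ⊛ c) ⊕ ((a' ⊕ neg z ⊛ b') ⊕ z ⊛ c') ≡ (a ⊕ a' ⊕ neg z ⊛ (b ⊕ b')) ⊕ z ⊛ (c ⊕ c')
  regroup = Solver.solve-∀ Zω-ring

SUM-recStep : ∀ z m F {G H} → Summable G → Summable H →
  SUM (λ n → recStep z m (F n) (G n) (H n)) ≈ recStep z m (SUM F) (SUM G) (SUM H)
SUM-recStep z m F {G} {H} G-summable H-summable = begin
  SUM (λ n → recStep z m (F n) (G n) (H n))
    ≈⟨ SUM-+S (λ n → F n +S scale (neg z) (shift (suc m) (G n))) (λ n → scale z (shift (4 + m) (H n))) ⟩
  SUM (λ n → F n +S scale (neg z) (shift (suc m) (G n))) +S SUM (λ n → scale z (shift (4 + m) (H n)))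
    ≈⟨ +S-cong (SUM-+S F (λ n → scale (neg z) (shift (suc m) (G n))))
               (≈-trans (SUM-scale z (λ n → shift (4 + m) (H n))) (scale-cong z (SUM-shift (4 + m) H-summable))) ⟩
  (SUM F +S SUM (λ n → scale (neg z) (shift (suc m) (G n)))) +S scale z (shift (4 + m) (SUM H))
    ≈⟨ +S-congʳ (scale z (shift (4 + m) (SUM H))) (+S-congˡ (SUM F)
         (≈-trans (SUM-scale (neg z) (λ n → shift (suc m) (G n))) (scale-cong (neg z) (SUM-shift (suc m) G-summable)))) ⟩
  recStep z m (SUM F) (SUM G) (SUM H) ∎
  where open ≈-Reasoning

recStep-agree : ∀ z m {f f' g g' h h'} N → f N ≡ f' N →
  (∀ M → M < N → g M ≡ g' M) → (∀ M → M < N → h M ≡ h' M) → recStep z m f g h N ≡ recStep z m f' g' h' N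
recStep-agree z m N f≡f' g≡g' h≡h' =
  cong₂ (λ x y → x ⊕ z ⊛ y)
    (cong₂ (λ x y → x ⊕ neg z ⊛ y) f≡f' (shift-agree (suc m) N (λ M M+1+m≤N → g≡g' M (<-≤-trans (m<m+n M z<s) M+1+m≤N))))
    (shift-agree (4 + m) N (λ M M+4+m≤N → h≡h' M (<-≤-trans (m<m+n M z<s) M+4+m≤N)))

Recurrence-unique : ∀ z X Y → Recurrence z X → Recurrence z Y →
  (∀ m N → N ≤ m → X m N ≡ Y m N) → ∀ m → X m ≈ Y m
Recurrence-unique z X Y X-rec Y-rec X≡Y-low m N = <-rec (λ N → ∀ m → X m N ≡ Y m N) agree N m
  where
  agree : ∀ N → (∀ {M} → M < N → ∀ m → X m M ≡ Y m M) → ∀ m → X m N ≡ Y m N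
  agree N X≡Y-below m = climb N m (m≤m+n N m)
    where
    climb : ∀ d m → N ≤ d + m → X m N ≡ Y m N
    climb zero    m N≤m     = X≡Y-low m N N≤m
    climb (suc d) m N≤1+d+m = begin
      X m N                                               ≡⟨ X-rec m N ⟩
      recStep z m (X (suc m)) (X (suc m)) (X (2 + m)) N
        ≡⟨ recStep-agree z m {X (suc m)} {Y (suc m)} {X (suc m)} {Y (suc m)} {X (2 + m)} {Y (2 + m)} N
                         (climb d (suc m) (subst (N ≤_) (sym (+-suc d m)) N≤1+d+m))
                         (λ M M<N → X≡Y-below M<N (suc m)) (λ M M<N → X≡Y-below M<N (2 + m)) ⟩
      recStep z m (Y (suc m)) (Y (suc m)) (Y (2 + m)) N   ≡⟨ Y-rec m N ⟨
      Y m N                                               ∎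
      where open ≡-Reasoning

-- Two solutions of the recurrence

tri : ℕ → ℕ
tri zero    = 0
tri (suc k) = tri k + suc k

n≤tri : ∀ n → n ≤ tri n
n≤tri zero    = z≤n
n≤tri (suc n) = m≤n+m (suc n) (tri n)

module _ (z : Zω) where

  Aprod : ℕ → ℕ → FPS
  Aprod m n = P n *S poch z (suc (m + n))

  Aterm : ℕ → ℕ → FPS
  Aterm m n = shift (3 * n) (Aprod m n)

  A : ℕ → FPS
  A m = SUM (Aterm m)

  Aterm-summable : ∀ m → Summable (Aterm m)
  Aterm-summable m n M M<n = shift-< (Aprod m n) (<-≤-trans M<n (m≤m+n n (2 * n)))

  Aprod-split-second : ∀ m n → Aprod m n ≈ [1- z q^ (suc (m + n)) ] Aprod (suc m) n
  Aprod-split-second m n =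
    ≈-trans (*S-congˡ (P n) (poch-suc z (suc (m + n)))) (*S-[1-]ʳ (P n) z (suc (m + n)) (poch z (suc (suc m + n))))

  Aprod-split-first : ∀ m n → Aprod (2 + m) n ≈ [1- oneω q^ (suc n) ] Aprod (suc m) (suc n)
  Aprod-split-first m n = begin
    P n *S Z                                ≈⟨ *S-congʳ Z (poch-suc oneω (suc n)) ⟩
    ([1- oneω q^ (suc n) ] P (suc n)) *S Z  ≈⟨ *S-[1-]ˡ oneω (suc n) (P (suc n)) Z ⟩
    [1- oneω q^ (suc n) ] (P (suc n) *S Z)  ≡⟨ cong (λ k → [1- oneω q^ (suc n) ] (P (suc n) *S poch z (suc k))) (sym (+-suc (suc m) n)) ⟩
    [1- oneω q^ (suc n) ] Aprod (suc m) (suc n) ∎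
    where
    open ≈-Reasoning
    Z = poch z (3 + m + n)

  Aterm-zero : ∀ m → Aterm m 0 ≈ recStep z m (Aterm (suc m) 0) (Aterm (suc m) 0) zeroS
  Aterm-zero m = begin
    Aprod m 0                                        ≈⟨ Aprod-split-second m 0 ⟩
    [1- z q^ (suc (m + 0)) ] Aprod (suc m) 0         ≡⟨ cong (λ k → [1- z q^ (suc k) ] Aprod (suc m) 0) (+-identityʳ m) ⟩
    [1- z q^ (suc m) ] Aprod (suc m) 0               ≈⟨ recStep-zeroS z m (Aprod (suc m) 0) (Aprod (suc m) 0) ⟨
    recStep z m (Aterm (suc m) 0) (Aterm (suc m) 0) zeroS ∎
    where open ≈-Reasoning

  Aterm-suc : ∀ m n → Aterm m (suc n) ≈ recStep z m (Aterm (suc m) (suc n)) (Aterm (suc m) (suc n)) (Aterm (2 + m) n)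
  Aterm-suc m n N = begin
    shift e (Aprod m (suc n)) N
      ≡⟨ trans (shift-cong e (Aprod-split-second m (suc n)) N) (shift-[1-] e z (suc (m + suc n)) t N) ⟩
    shift e t N ⊕ neg z ⊛ shift (e + suc (m + suc n)) t N
      ≡⟨ cong (λ k → shift e t N ⊕ neg z ⊛ shift k t N) (exponent₂ m n) ⟩
    shift e t N ⊕ neg z ⊛ shift (f + suc n) t N
      ≡⟨ split z (shift e t N) (shift f t N) (shift (f + suc n) t N) ⟩
    (shift e t N ⊕ neg z ⊛ shift f t N) ⊕ z ⊛ (shift f t N ⊕ neg oneω ⊛ shift (f + suc n) t N)
      ≡⟨ cong₂ (λ u v → (shift e t N ⊕ neg z ⊛ u) ⊕ z ⊛ v)
           (sym (trans (shift-shift (suc m) e t N) (cong (λ k → shift k t N) (exponent₁ m n))))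
           (sym (trans (shift-shift (4 + m) (3 * n) (Aprod (2 + m) n) N)
                 (trans (shift-cong f (Aprod-split-first m n) N) (shift-[1-] f oneω (suc n) t N)))) ⟩
    recStep z m (Aterm (suc m) (suc n)) (Aterm (suc m) (suc n)) (Aterm (2 + m) n) N ∎
    where
    open ≡-Reasoning
    e = 3 * suc n
    f = 4 + m + 3 * n
    t = Aprod (suc m) (suc n)
    exponent₁ : ∀ m n → suc m + 3 * suc n ≡ 4 + m + 3 * n
    exponent₁ = solve-∀
    exponent₂ : ∀ m n → 3 * suc n + suc (m + suc n) ≡ 4 + m + 3 * n + suc n
    exponent₂ = solve-∀
    split : ∀ c x y w → x ⊕ neg c ⊛ w ≡ (x ⊕ neg c ⊛ y) ⊕ c ⊛ (y ⊕ neg oneω ⊛ w)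
    split = Solver.solve-∀ Zω-ring

  A-recurrence : Recurrence z A
  A-recurrence m = begin
    A m
      ≈⟨ SUM-suc (Aterm-summable m) ⟩
    Aterm m 0 +S SUM (λ n → Aterm m (suc n))
      ≈⟨ +S-cong (Aterm-zero m) (SUM-cong (Aterm-suc m)) ⟩
    recStep z m a₀ a₀ zeroS +S SUM (λ n → recStep z m (Aterm (suc m) (suc n)) (Aterm (suc m) (suc n)) (Aterm (2 + m) n))
      ≈⟨ +S-congˡ (recStep z m a₀ a₀ zeroS)
           (SUM-recStep z m (λ n → Aterm (suc m) (suc n)) (Summable-suc (Aterm-summable (suc m))) (Aterm-summable (2 + m))) ⟩
    recStep z m a₀ a₀ zeroS +S recStep z m a₊ a₊ (A (2 + m))
      ≈⟨ recStep-+S z m a₀ a₀ zeroS a₊ a₊ (A (2 + m)) ⟩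
    recStep z m (a₀ +S a₊) (a₀ +S a₊) (zeroS +S A (2 + m))
      ≈⟨ recStep-cong z m (SUM-suc (Aterm-summable (suc m))) (SUM-suc (Aterm-summable (suc m))) (≈-sym (+S-identityˡ (A (2 + m)))) ⟨
    recStep z m (A (suc m)) (A (suc m)) (A (2 + m)) ∎
    where
    open ≈-Reasoning
    a₀ = Aterm (suc m) 0
    a₊ = SUM (λ n → Aterm (suc m) (suc n))

  A-low : ∀ m N → N ≤ m → A m N ≡ B 3 N
  A-low m N N≤m = sumTo-cong N (λ n _ → shift-agree (3 * n) N (λ M M+3n≤N →
    *S-agrees-with-oneS (P n) (poch z (suc (m + n))) M (λ i i≤M →
      poch-below z (suc (m + n)) i (s≤s (i≤m+n n (≤-trans i≤M (≤-trans (m≤m+n M (3 * n)) M+3n≤N)))))))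
    where
    i≤m+n : ∀ n {i} → i ≤ N → i ≤ m + n
    i≤m+n n i≤N = ≤-trans i≤N (≤-trans N≤m (m≤m+n m n))

  Rterm : ℕ → ℕ → FPS
  Rterm m k = scale (pow (neg z) k) (shift (m * k + tri k) (pochFin oneω (suc k) 2))

  R : ℕ → FPS
  R m = SUM (Rterm m)

  Rterm-summable : ∀ m → Summable (Rterm m)
  Rterm-summable m k M M<k = trans (cong (pow (neg z) k ⊛_) (shift-< (pochFin oneω (suc k) 2) M<exponent)) (⊛-zeroʳ (pow (neg z) k))
    where
    M<exponent : M < m * k + tri k
    M<exponent = <-≤-trans M<k (≤-trans (n≤tri k) (m≤n+m (tri k) (m * k)))

  -- Rterm (suc m) 0 and Rterm m 0 agree definitionally, as suc m * 0 reduces to m * 0.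
  Rterm-zero : ∀ m → Rterm m 0 ≈ recStep z m (Rterm (suc m) 0) zeroS zeroS
  Rterm-zero m N = sym (trans (recStep-zeroS z m (Rterm m 0) zeroS N)
    (trans (cong (λ x → Rterm m 0 N ⊕ neg z ⊛ x) (shift-zeroS (suc m) N)) (⊕-⊛-zeroʳ (Rterm m 0 N) (neg z))))

  Rterm-suc : ∀ m k → Rterm m (suc k) ≈ recStep z m (Rterm (suc m) (suc k)) (Rterm (suc m) k) (Rterm (2 + m) k)
  Rterm-suc m k N = begin
    c′ ⊛ X₀
      ≡⟨ cong (c′ ⊛_) (trans (add-difference X₀ X₁) (cong (X₁ ⊕_) X₀-X₁≡Y₀-Y₁)) ⟩
    c′ ⊛ (X₁ ⊕ (Y₀ ⊕ neg oneω ⊛ Y₁))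
      ≡⟨ distribute z c X₁ Y₀ Y₁ ⟩
    (c′ ⊛ X₁ ⊕ neg z ⊛ (c ⊛ Y₀)) ⊕ z ⊛ (c ⊛ Y₁)
      ≡⟨ cong₂ (λ u v → (c′ ⊛ u ⊕ neg z ⊛ v) ⊕ z ⊛ (c ⊛ Y₁))
           (cong (λ i → shift i p′ N) (sym (exponent₁ (tri k) m k)))
           (sym (trans (shift-scale-shift (suc m) c (suc m * k + tri k) p N) (cong (λ i → c ⊛ shift i p N) (exponent₂ (tri k) m k)))) ⟩
    (c′ ⊛ shift (suc m * suc k + tri (suc k)) p′ N ⊕ neg z ⊛ shift (suc m) (Rterm (suc m) k) N) ⊕ z ⊛ (c ⊛ Y₁)
      ≡⟨ cong (λ v → (c′ ⊛ shift (suc m * suc k + tri (suc k)) p′ N ⊕ neg z ⊛ shift (suc m) (Rterm (suc m) k) N) ⊕ z ⊛ v)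
           (sym (trans (shift-scale-shift (4 + m) c ((2 + m) * k + tri k) p N) (cong (λ i → c ⊛ shift i p N) (exponent₃ (tri k) m k)))) ⟩
    recStep z m (Rterm (suc m) (suc k)) (Rterm (suc m) k) (Rterm (2 + m) k) N ∎
    where
    open ≡-Reasoning
    c  = pow (neg z) k
    c′ = pow (neg z) (suc k)
    p  = pochFin oneω (suc k) 2
    p′ = pochFin oneω (2 + k) 2
    E  = m * suc k + tri (suc k)
    X₀ = shift E p′ N
    X₁ = shift (E + suc k) p′ N
    Y₀ = shift E p N
    Y₁ = shift (E + (suc k + 2)) p N
    X₀-X₁≡Y₀-Y₁ : X₀ ⊕ neg oneω ⊛ X₁ ≡ Y₀ ⊕ neg oneω ⊛ Y₁
    X₀-X₁≡Y₀-Y₁ = trans (sym (shift-[1-] E oneω (suc k) p′ N))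
                    (trans (shift-cong E (pochFin-first≈last oneω (suc k) 2) N) (shift-[1-] E oneω (suc k + 2) p N))
    add-difference : ∀ x y → x ≡ y ⊕ (x ⊕ neg oneω ⊛ y)
    add-difference = Solver.solve-∀ Zω-ring
    distribute : ∀ z c x y w →
      (c ⊛ neg z) ⊛ (x ⊕ (y ⊕ neg oneω ⊛ w)) ≡ ((c ⊛ neg z) ⊛ x ⊕ neg z ⊛ (c ⊛ y)) ⊕ z ⊛ (c ⊛ w)
    distribute = Solver.solve-∀ Zω-ring
    exponent₁ : ∀ t m k → suc m * suc k + (t + suc k) ≡ m * suc k + (t + suc k) + suc k
    exponent₁ = solve-∀
    exponent₂ : ∀ t m k → suc m + (suc m * k + t) ≡ m * suc k + (t + suc k)
    exponent₂ = solve-∀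
    exponent₃ : ∀ t m k → 4 + m + ((2 + m) * k + t) ≡ m * suc k + (t + suc k) + (suc k + 2)
    exponent₃ = solve-∀

  R-recurrence : Recurrence z R
  R-recurrence m = begin
    R m
      ≈⟨ SUM-suc (Rterm-summable m) ⟩
    Rterm m 0 +S SUM (λ k → Rterm m (suc k))
      ≈⟨ +S-cong (Rterm-zero m) (SUM-cong (Rterm-suc m)) ⟩
    recStep z m r₀ zeroS zeroS +S SUM (λ k → recStep z m (Rterm (suc m) (suc k)) (Rterm (suc m) k) (Rterm (2 + m) k))
      ≈⟨ +S-congˡ (recStep z m r₀ zeroS zeroS)
           (SUM-recStep z m (λ k → Rterm (suc m) (suc k)) (Rterm-summable (suc m)) (Rterm-summable (2 + m))) ⟩
    recStep z m r₀ zeroS zeroS +S recStep z m r₊ (R (suc m)) (R (2 + m))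
      ≈⟨ recStep-+S z m r₀ zeroS zeroS r₊ (R (suc m)) (R (2 + m)) ⟩
    recStep z m (r₀ +S r₊) (zeroS +S R (suc m)) (zeroS +S R (2 + m))
      ≈⟨ recStep-cong z m (SUM-suc (Rterm-summable (suc m))) (≈-sym (+S-identityˡ (R (suc m)))) (≈-sym (+S-identityˡ (R (2 + m)))) ⟨
    recStep z m (R (suc m)) (R (suc m)) (R (2 + m)) ∎
    where
    open ≈-Reasoning
    r₀ = Rterm (suc m) 0
    r₊ = SUM (λ k → Rterm (suc m) (suc k))

  R-low : ∀ m N → N ≤ m → R m N ≡ pochFin oneω 1 2 N
  R-low m N N≤m = begin
    R m N
      ≡⟨ SUM-suc (Rterm-summable m) N ⟩
    Rterm m 0 N ⊕ SUM (λ k → Rterm m (suc k)) N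
      ≡⟨ cong₂ _⊕_ first-term (sumTo-zero N (λ k _ → later-term k)) ⟩
    p₀ N ⊕ zeroω
      ≡⟨ ⊕-identityʳ (p₀ N) ⟩
    p₀ N ∎
    where
    open ≡-Reasoning
    p₀ = pochFin oneω 1 2
    first-term : Rterm m 0 N ≡ p₀ N
    first-term = trans (cong (λ i → oneω ⊛ shift i p₀ N) (trans (+-identityʳ (m * 0)) (*-zeroʳ m))) (⊛-identityˡ (p₀ N))
    N<exponent : ∀ k → N < m * suc k + tri (suc k)
    N<exponent k = ≤-<-trans (≤-trans N≤m (m≤m*n m (suc k))) (m<m+n (m * suc k) (<-≤-trans z<s (m≤n+m (suc k) (tri k))))
    later-term : ∀ k → Rterm m (suc k) N ≡ zeroω
    later-term k = trans (cong (pow (neg z) (suc k) ⊛_) (shift-< (pochFin oneω (2 + k) 2) (N<exponent k))) (⊛-zeroʳ (pow (neg z) (suc k)))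

  A≈R : ∀ m → A m ≈ R m
  A≈R = Recurrence-unique z A R A-recurrence R-recurrence
          (λ m N N≤m → trans (A-low m N N≤m) (trans (B≈pochFin 2 N) (sym (R-low m N N≤m))))

-- Telescoping

tri-series : (ℕ → Zω) → FPS
tri-series t = SUM (λ k → scale (t k) (shift (tri k) (pochFin oneω (suc k) 2)))

tri-term-expand : ∀ c k → scale c (shift (tri k) (pochFin oneω (suc k) 2)) ≈
  ((mono c (tri k) +S mono (neg c) (tri (suc k))) +S mono c (tri (2 + k))) +S mono (neg c) (suc (tri (suc k)))
tri-term-expand c k N = begin
  c ⊛ shift T (pochFin oneω (suc k) 2) N
    ≡⟨ cong (c ⊛_) (shift-cong T (≈-trans (pochFin-suc oneω (suc k) 1) ([1-]-cong oneω j₂ (pochFin-suc oneω (suc k) 0))) N) ⟩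
  c ⊛ shift T ([1- oneω q^ j₂ ] F) N
    ≡⟨ cong (c ⊛_) (shift-[1-] T oneω j₂ F N) ⟩
  c ⊛ (shift T F N ⊕ neg oneω ⊛ shift (T + j₂) F N)
    ≡⟨ cong (c ⊛_) (cong₂ (λ x y → x ⊕ neg oneω ⊛ y) (shift-[1-] T oneω j₁ oneS N)
                                                   (shift-[1-] (T + j₂) oneω j₁ oneS N)) ⟩
  c ⊛ ((Q T ⊕ neg oneω ⊛ Q (T + j₁)) ⊕ neg oneω ⊛ (Q (T + j₂) ⊕ neg oneω ⊛ Q (T + j₂ + j₁)))
    ≡⟨ distribute c (Q T) (Q (T + j₁)) (Q (T + j₂)) (Q (T + j₂ + j₁)) ⟩
  ((c ⊛ Q T ⊕ neg c ⊛ Q (T + j₁)) ⊕ c ⊛ Q (T + j₂ + j₁)) ⊕ neg c ⊛ Q (T + j₂)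
    ≡⟨ cong₂ _⊕_ (cong₂ _⊕_ (cong₂ _⊕_ (to-mono c refl) (to-mono (neg c) (exponent₁ T k))) (to-mono c (exponent₂ T k)))
                 (to-mono (neg c) (exponent₃ T k)) ⟩
  ((mono c (tri k) N ⊕ mono (neg c) (tri (suc k)) N) ⊕ mono c (tri (2 + k)) N) ⊕ mono (neg c) (suc (tri (suc k))) N ∎
  where
  open ≡-Reasoning
  T = tri k
  j₁ = suc k + 0
  j₂ = suc k + 1
  F = [1- oneω q^ j₁ ] oneS
  Q : ℕ → Zω
  Q e = shift e oneS N
  to-mono : ∀ a {e e′} → e ≡ e′ → a ⊛ Q e ≡ mono a e′ N
  to-mono a {e} refl = sym (mono≈scale-shift a e N)
  exponent₁ : ∀ t k → t + (suc k + 0) ≡ t + suc k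
  exponent₁ = solve-∀
  exponent₂ : ∀ t k → t + (suc k + 1) + (suc k + 0) ≡ t + suc k + suc (suc k)
  exponent₂ = solve-∀
  exponent₃ : ∀ t k → t + (suc k + 1) ≡ suc (t + suc k)
  exponent₃ = solve-∀
  distribute : ∀ c x y z w →
    c ⊛ ((x ⊕ neg oneω ⊛ y) ⊕ neg oneω ⊛ (z ⊕ neg oneω ⊛ w)) ≡ ((c ⊛ x ⊕ neg c ⊛ y) ⊕ c ⊛ w) ⊕ neg c ⊛ z
  distribute = Solver.solve-∀ Zω-ring

collisions-cancel : ∀ t → (∀ k → t (2 + k) ⊖ t (suc k) ⊕ t k ≡ zeroω) →
  SUM (λ k → (mono (t k) (tri k) +S mono (neg (t k)) (tri (suc k))) +S mono (t k) (tri (2 + k))) ≈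
  mono (t 0) 0 +S mono (t 1 ⊖ t 0) 1
collisions-cancel t t-rec N = begin
  SUM (λ k → (G₀ k +S G₁ k) +S G₂ k) N
    ≡⟨ trans (SUM-+S (λ k → G₀ k +S G₁ k) G₂ N) (cong (_⊕ SUM G₂ N) (SUM-+S G₀ G₁ N)) ⟩
  (SUM G₀ N ⊕ SUM G₁ N) ⊕ SUM G₂ N
    ≡⟨ cong₂ (λ x y → (x ⊕ y) ⊕ SUM G₂ N)
             (trans (SUM-suc G₀-summable N) (cong (G₀ 0 N ⊕_) (SUM-suc (Summable-suc G₀-summable) N)))
             (SUM-suc G₁-summable N) ⟩
  (G₀ 0 N ⊕ (G₀ 1 N ⊕ S₀)) ⊕ (G₁ 0 N ⊕ S₁) ⊕ SUM G₂ N
    ≡⟨ regroup (G₀ 0 N) (G₀ 1 N) S₀ (G₁ 0 N) S₁ (SUM G₂ N) ⟩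
  (G₀ 0 N ⊕ (G₀ 1 N ⊕ G₁ 0 N)) ⊕ ((S₀ ⊕ S₁) ⊕ SUM G₂ N)
    ≡⟨ cong₂ (λ x y → (G₀ 0 N ⊕ x) ⊕ y) (mono-⊕ (t 1) (neg (t 0)) 1 N) tail-vanishes ⟩
  (mono (t 0) 0 N ⊕ mono (t 1 ⊖ t 0) 1 N) ⊕ zeroω
    ≡⟨ ⊕-identityʳ _ ⟩
  mono (t 0) 0 N ⊕ mono (t 1 ⊖ t 0) 1 N ∎
  where
  open ≡-Reasoning
  G₀ G₁ G₂ : ℕ → FPS
  G₀ k = mono (t k) (tri k)
  G₁ k = mono (neg (t k)) (tri (suc k))
  G₂ k = mono (t k) (tri (2 + k))
  G₀-summable : Summable G₀
  G₀-summable = mono-summable t tri n≤tri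
  G₁-summable : Summable G₁
  G₁-summable = mono-summable (λ k → neg (t k)) (λ k → tri (suc k)) (λ k → ≤-trans (n≤1+n k) (n≤tri (suc k)))
  S₀ = SUM (λ k → G₀ (2 + k)) N
  S₁ = SUM (λ k → G₁ (suc k)) N
  regroup : ∀ a b c d e f → ((a ⊕ (b ⊕ c)) ⊕ (d ⊕ e)) ⊕ f ≡ (a ⊕ (b ⊕ d)) ⊕ ((c ⊕ e) ⊕ f)
  regroup = Solver.solve-∀ Zω-ring
  tail-vanishes : (S₀ ⊕ S₁) ⊕ SUM G₂ N ≡ zeroω
  tail-vanishes = begin
    (S₀ ⊕ S₁) ⊕ SUM G₂ N
      ≡⟨ cong (_⊕ SUM G₂ N) (SUM-+S (λ k → G₀ (2 + k)) (λ k → G₁ (suc k)) N) ⟨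
    SUM (λ k → G₀ (2 + k) +S G₁ (suc k)) N ⊕ SUM G₂ N
      ≡⟨ SUM-+S (λ k → G₀ (2 + k) +S G₁ (suc k)) G₂ N ⟨
    SUM (λ k → (G₀ (2 + k) +S G₁ (suc k)) +S G₂ k) N
      ≡⟨ sumTo-zero N (λ k _ → begin
           (G₀ (2 + k) N ⊕ G₁ (suc k) N) ⊕ G₂ k N
             ≡⟨ trans (cong (_⊕ G₂ k N) (mono-⊕ (t (2 + k)) (neg (t (suc k))) (tri (2 + k)) N))
                      (mono-⊕ (t (2 + k) ⊖ t (suc k)) (t k) (tri (2 + k)) N) ⟩
           mono (t (2 + k) ⊖ t (suc k) ⊕ t k) (tri (2 + k)) N
             ≡⟨ cong (λ c → mono c (tri (2 + k)) N) (t-rec k) ⟩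
           mono zeroω (tri (2 + k)) N
             ≡⟨ mono-zeroω (tri (2 + k)) N ⟩
           zeroω ∎) ⟩
    zeroω ∎

tri-series-closed : (ℕ → Zω) → FPS
tri-series-closed t = (mono (t 0) 0 +S mono (t 1 ⊖ t 0) 1) +S SUM (λ k → mono (neg (t k)) (suc (tri (suc k))))

tri-series-telescopes : ∀ t → (∀ k → t (2 + k) ⊖ t (suc k) ⊕ t k ≡ zeroω) → tri-series t ≈ tri-series-closed t
tri-series-telescopes t t-rec = begin
  tri-series t
    ≈⟨ SUM-cong (λ k → tri-term-expand (t k) k) ⟩
  SUM (λ k → G k +S H k)
    ≈⟨ SUM-+S G H ⟩
  SUM G +S SUM H
    ≈⟨ +S-congʳ (SUM H) (collisions-cancel t t-rec) ⟩
  (mono (t 0) 0 +S mono (t 1 ⊖ t 0) 1) +S SUM H ∎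
  where
  open ≈-Reasoning
  G H : ℕ → FPS
  G k = (mono (t k) (tri k) +S mono (neg (t k)) (tri (suc k))) +S mono (t k) (tri (2 + k))
  H k = mono (neg (t k)) (suc (tri (suc k)))

suc-C-2≡tri : ∀ k → suc k C 2 ≡ tri k
suc-C-2≡tri zero    = refl
suc-C-2≡tri (suc k) = begin
  suc (suc k) C 2       ≡⟨ nCk+nC[k+1]≡[n+1]C[k+1] (suc k) 1 ⟨
  suc k C 1 + suc k C 2 ≡⟨ cong₂ _+_ (nC1≡n (suc k)) (suc-C-2≡tri k) ⟩
  suc k + tri k         ≡⟨ +-comm (suc k) (tri k) ⟩
  tri (suc k)           ∎
  where open ≡-Reasoning

pow-neg : ∀ x n → pow (neg x) n ≡ pow (neg oneω) n ⊛ pow x n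
pow-neg x zero    = refl
pow-neg x (suc n) = trans (cong (_⊛ neg x) (pow-neg x n)) (rearrange (pow (neg oneω) n) (pow x n) x)
  where
  rearrange : ∀ s u x → (s ⊛ u) ⊛ neg x ≡ (s ⊛ neg oneω) ⊛ (u ⊛ x)
  rearrange = Solver.solve-∀ Zω-ring

pow-recurrence : ∀ x → x ⊛ x ⊖ x ⊕ oneω ≡ zeroω → ∀ k → pow x (2 + k) ⊖ pow x (suc k) ⊕ pow x k ≡ zeroω
pow-recurrence x x²-x+1≡0 k =
  trans (factor (pow x k) x) (trans (cong (pow x k ⊛_) x²-x+1≡0) (⊛-zeroʳ (pow x k)))
  where
  factor : ∀ p x → (p ⊛ x) ⊛ x ⊖ p ⊛ x ⊕ p ≡ p ⊛ (x ⊛ x ⊖ x ⊕ oneω)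
  factor = Solver.solve-∀ Zω-ring

signedχ₃ : ℕ → Zω
signedχ₃ k = pow (neg ω) k ⊕ pow (neg ω²) k

signedχ₃≡ : ∀ k → signedχ₃ k ≡ pow (neg oneω) k ⊛ χ₃ k
signedχ₃≡ k = trans (cong₂ _⊕_ (pow-neg ω k) (pow-neg ω² k)) (sym (⊛-distribˡ-⊕ (pow (neg oneω) k) (pow ω k) (pow ω² k)))

signedχ₃-recurrence : ∀ k → signedχ₃ (2 + k) ⊖ signedχ₃ (suc k) ⊕ signedχ₃ k ≡ zeroω
signedχ₃-recurrence k =
  trans (interleave (u (2 + k)) (u (suc k)) (u k) (v (2 + k)) (v (suc k)) (v k))
        (cong₂ _⊕_ (pow-recurrence (neg ω) refl k) (pow-recurrence (neg ω²) refl k))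
  where
  u v : ℕ → Zω
  u = pow (neg ω)
  v = pow (neg ω²)
  interleave : ∀ a b c a′ b′ c′ → (a ⊕ a′) ⊖ (b ⊕ b′) ⊕ (c ⊕ c′) ≡ (a ⊖ b ⊕ c) ⊕ (a′ ⊖ b′ ⊕ c′)
  interleave = Solver.solve-∀ Zω-ring

E3≡A+A : ∀ N → E3 N ≡ A ω 0 N ⊕ A ω² 0 N
E3≡A+A N = trans (sumTo-cong N (λ n _ → split n)) (sumTo-⊕ (λ n → Aterm ω 0 n N) (λ n → Aterm ω² 0 n N) N)
  where
  split : ∀ n → eps3summand n N ≡ Aterm ω 0 n N ⊕ Aterm ω² 0 n N
  split n = trans (shift-cong (3 * n) (*S-distribˡ (P n) (poch ω (suc n)) (poch ω² (suc n))) N)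
                  (shift-+S (3 * n) (P n *S poch ω (suc n)) (P n *S poch ω² (suc n)) N)

R+R≡tri-series : ∀ z z′ N → R z 0 N ⊕ R z′ 0 N ≡ tri-series (λ k → pow (neg z) k ⊕ pow (neg z′) k) N
R+R≡tri-series z z′ N =
  trans (sym (sumTo-⊕ (λ k → Rterm z 0 k N) (λ k → Rterm z′ 0 k N) N))
        (sumTo-cong N (λ k _ → sym (⊛-distribʳ-⊕ (shift (tri k) (pochFin oneω (suc k) 2) N) (pow (neg z) k) (pow (neg z′) k))))

rhsTerm-suc-suc : ∀ k → rhsTerm (2 + k) ≈ mono (neg (signedχ₃ (suc k))) (suc (tri (2 + k)))
rhsTerm-suc-suc k M =
  cong₂ (λ c e → mono c (suc e) M)
        (trans (sign-flip (pow (neg oneω) (suc k)) (χ₃ (suc k))) (cong neg (sym (signedχ₃≡ (suc k)))))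
        (suc-C-2≡tri (2 + k))
  where
  sign-flip : ∀ s c → (s ⊛ neg oneω) ⊛ c ≡ neg (s ⊛ c)
  sign-flip = Solver.solve-∀ Zω-ring

rhsTerm-summable : Summable rhsTerm
rhsTerm-summable 1             M _      = refl
rhsTerm-summable (suc (suc k)) M M<2+k =
  trans (rhsTerm-suc-suc k M) (mono-below (neg (signedχ₃ (suc k))) (<-≤-trans M<2+k (≤-trans (n≤tri (2 + k)) (n≤1+n _))))

-- The guard 2 ≤ᵇ n makes rhsTerm 0 and rhsTerm 1 vanish, and the constants 2, -1, -2 of rhs
-- compute to signedχ₃ 0, signedχ₃ 1 ⊖ signedχ₃ 0 and neg (signedχ₃ 0).
rhs≡tri-series-closed : ∀ N → rhs N ≡ tri-series-closed signedχ₃ N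
rhs≡tri-series-closed N = begin
  ((m₀ ⊕ m₁) ⊕ m₂) ⊕ SUM rhsTerm N
    ≡⟨ cong (((m₀ ⊕ m₁) ⊕ m₂) ⊕_)
            (trans (SUM-suc rhsTerm-summable N) (cong (zeroω ⊕_) (SUM-suc (Summable-suc rhsTerm-summable) N))) ⟩
  ((m₀ ⊕ m₁) ⊕ m₂) ⊕ (zeroω ⊕ (zeroω ⊕ SUM (λ k → rhsTerm (2 + k)) N))
    ≡⟨ cong (λ x → ((m₀ ⊕ m₁) ⊕ m₂) ⊕ (zeroω ⊕ (zeroω ⊕ x))) (SUM-cong rhsTerm-suc-suc N) ⟩
  ((m₀ ⊕ m₁) ⊕ m₂) ⊕ (zeroω ⊕ (zeroω ⊕ SUM (λ k → H (suc k)) N))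
    ≡⟨ drop-zeros m₀ m₁ m₂ (SUM (λ k → H (suc k)) N) ⟩
  (m₀ ⊕ m₁) ⊕ (H 0 N ⊕ SUM (λ k → H (suc k)) N)
    ≡⟨ cong ((m₀ ⊕ m₁) ⊕_) (SUM-suc (mono-summable (λ k → neg (signedχ₃ k)) (λ k → suc (tri (suc k))) k≤exponent) N) ⟨
  (m₀ ⊕ m₁) ⊕ SUM H N ∎
  where
  open ≡-Reasoning
  m₀ = mono (ι (+ 2)) 0 N
  m₁ = mono (ι -[1+ 0 ]) 1 N
  m₂ = mono (ι -[1+ 1 ]) 2 N
  H : ℕ → FPS
  H k = mono (neg (signedχ₃ k)) (suc (tri (suc k)))
  k≤exponent : ∀ k → k ≤ suc (tri (suc k))
  k≤exponent k = ≤-trans (n≤1+n k) (s≤s (≤-trans (n≤1+n k) (n≤tri (suc k))))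
  drop-zeros : ∀ a b c x → ((a ⊕ b) ⊕ c) ⊕ (zeroω ⊕ (zeroω ⊕ x)) ≡ (a ⊕ b) ⊕ (c ⊕ x)
  drop-zeros = Solver.solve-∀ Zω-ring

theorem1p5 : (N : ℕ) → E3 N ≡ rhs N
theorem1p5 N = begin
  E3 N                         ≡⟨ E3≡A+A N ⟩
  A ω 0 N ⊕ A ω² 0 N           ≡⟨ cong₂ _⊕_ (A≈R ω 0 N) (A≈R ω² 0 N) ⟩
  R ω 0 N ⊕ R ω² 0 N           ≡⟨ R+R≡tri-series ω ω² N ⟩
  tri-series signedχ₃ N        ≡⟨ tri-series-telescopes signedχ₃ signedχ₃-recurrence N ⟩
  tri-series-closed signedχ₃ N ≡⟨ rhs≡tri-series-closed N ⟨
  rhs N                        ∎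
  where open ≡-Reasoning
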